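{- Let $(h(n))_{n\in\mathbb{N}}$ be defined by $h(n)=1$ for all integers $n\le 1$ and $h(n)=h(n-h(n-1))+h(n-2)$ for $n>1$. Then the subsequence $(h(2n))_{n\in\mathbb{N}}$, and hence the whole sequence $(h(n))_{n\in\mathbb{N}}$, is not $k$-regular for any integer $k\ge2$.
   Context: For an integer $k\ge 2$, the $k$-kernel of a sequence $\mathbf{a}=(a_n)_{n\in\mathbb{N}}$ is the set $\{(a_{k^jn+i})_{n\in\mathbb{N}}: j\in\mathbb{N},\ 0\le i<k^j\}$. A sequence with values in a $\mathbb{Z}$-module is $k$-regular if the $\mathbb{Z}$-submodule generated by its $k$-kernel is finitely generated. -}

module Defs where

open import Data.Nat using (ℕ; zero; suc; _+_; _*_; _∸_; _^_; _<_; _≤ᵇ_)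
open import Data.Bool using (if_then_else_)
open import Data.Integer using (ℤ; +_) renaming (_+_ to _+ℤ_; _*_ to _*ℤ_)
open import Data.Fin using (Fin; zero; suc)
open import Data.Product using (Σ; ∃; _×_; _,_)
open import Data.List using (List; []; _∷_; map; upTo)
open import Relation.Binary.PropositionalEquality using (_≡_; refl)

-- The sequence h:  h(n) = 1 for n ≤ 1 (including all negative n),
-- h(n) = h(n - h(n-1)) + h(n-2) for n > 1.
-- All values are ≥ 1, so n - h(n-1) ≤ n - 1; when n - h(n-1) ≤ 0 the
-- value h(n - h(n-1)) is 1 = h(0), which is why truncated subtraction ∸
-- is harmless.  We compute h by a table: tab n i = h(i) for i ≤ n.

tab : ℕ → ℕ → ℕ
tab zero    i = 1
tab (suc n) i = if i ≤ᵇ n then tab n i else new n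
  where
  new : ℕ → ℕ
  new zero    = 1
  new (suc m) = tab n (suc (suc m) ∸ tab n (suc m)) + tab n m

h : ℕ → ℕ
h n = tab n n

_ : map h (upTo 7) ≡ 1 ∷ 1 ∷ 2 ∷ 2 ∷ 4 ∷ 3 ∷ 6 ∷ []
_ = refl

Seq : Set
Seq = ℕ → ℤ

InKernel : ℕ → Seq → Seq → Set
InKernel k a s = Σ ℕ λ j → Σ ℕ λ i → (i < k ^ j) × (∀ n → s n ≡ a (k ^ j * n + i))

sumFin : (r : ℕ) → (Fin r → ℤ) → ℤ
sumFin zero    f = + 0
sumFin (suc r) f = f zero +ℤ sumFin r (λ t → f (suc t))

InSpan : (Seq → Set) → Seq → Set
InSpan P s = Σ ℕ λ r → Σ (Fin r → Seq) λ gs → Σ (Fin r → ℤ) λ cs →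
  (∀ t → P (gs t)) × (∀ n → s n ≡ sumFin r (λ t → cs t *ℤ gs t n))

FinSet : (r : ℕ) → (Fin r → Seq) → Seq → Set
FinSet r G g = Σ (Fin r) λ t → ∀ n → g n ≡ G t n

-- a is k-regular: the ℤ-submodule generated by its k-kernel is finitely
-- generated, i.e. it is spanned by finitely many of its own elements.
Regular : ℕ → Seq → Set
Regular k a = Σ ℕ λ r → Σ (Fin r → Seq) λ G →
  (∀ t → InSpan (InKernel k a) (G t)) ×
  (∀ s → InSpan (InKernel k a) s → InSpan (FinSet r G) s)

{-# OPTIONS --safe #-}
-- On odd indices h(2n+1) = n + 1, and then the recurrence on even indices
-- becomes h(2n+2) = h(n+1) + h(2n).  Hence hEven(n) = h(2n) satisfies
-- hEven(4m) ≥ m·hEven(m), so hEven(4^L) outgrows every exponential C^L.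
-- A k-regular sequence, on the other hand, is bounded on [0, k^L) by A·C^L:
-- if G₁, …, G_r generate the ℤ-module spanned by its k-kernel, then
-- M(n) = Σ_t |G_t(n)| satisfies M(kn + d) ≤ C·M(n) for every digit d < k.
module Submission where

open import Defs
open import Data.Bool using (true; false)
open import Data.Bool.Properties using (T-≡)
open import Data.Empty using (⊥-elim)
open import Data.Fin as Fin using (Fin; toℕ; fromℕ<)
open import Data.Fin.Properties using (toℕ<n; toℕ-fromℕ<)
open import Data.Integer as ℤ using (+_; ∣_∣)
import Data.Integer.Properties as ℤ
open import Data.Nat
open import Data.Nat.DivMod using (_/_; _%_; m%n<n; m≡m%n+[m/n]*n; m<n*o⇒m/o<n)
open import Data.Nat.Properties
open import Data.Nat.Tactic.RingSolver using (solve-∀)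
open import Data.Product using (_×_; _,_; proj₁; proj₂; ∃)
open import Data.Sum using (inj₁; inj₂)
open import Function using (_∘_; Equivalence)
open import Relation.Binary.PropositionalEquality
open import Relation.Nullary using (¬_; yes; no)

n<2^n : ∀ n → n < 2 ^ n
n<2^n zero    = s≤s z≤n
n<2^n (suc n) = begin-strict
  1 + n         <⟨ +-mono-≤-< (m^n>0 2 n) (n<2^n n) ⟩
  2 ^ n + 2 ^ n ≡⟨ cong (λ x → 2 ^ n + x) (+-identityʳ (2 ^ n)) ⟨
  2 ^ suc n     ∎
  where open ≤-Reasoning

^-distribʳ-* : ∀ m n o → (m * n) ^ o ≡ m ^ o * n ^ o
^-distribʳ-* m n zero    = refl
^-distribʳ-* m n (suc o) = trans (cong (m * n *_) (^-distribʳ-* m n o)) (interchange m n (m ^ o) (n ^ o))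
  where
  interchange : ∀ a b x y → a * b * (x * y) ≡ a * x * (b * y)
  interchange = solve-∀

module _ (f : ℕ → ℕ) (f-grows : ∀ L → 4 ^ L * f L ≤ f (suc L)) where

  f-geometric : ∀ {q L₀} → q ≤ 4 ^ L₀ → ∀ m → f L₀ * q ^ m ≤ f (m + L₀)
  f-geometric {q} {L₀} q≤4^L₀ zero    = ≤-reflexive (*-identityʳ (f L₀))
  f-geometric {q} {L₀} q≤4^L₀ (suc m) = begin
    f L₀ * (q * q ^ m)        ≡⟨ x*[y*z]≡y*[x*z] (f L₀) q (q ^ m) ⟩
    q * (f L₀ * q ^ m)        ≤⟨ *-mono-≤ (≤-trans q≤4^L₀ (^-monoʳ-≤ 4 (m≤n+m L₀ m))) (f-geometric q≤4^L₀ m) ⟩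
    4 ^ (m + L₀) * f (m + L₀) ≤⟨ f-grows (m + L₀) ⟩
    f (suc m + L₀)            ∎
    where
    open ≤-Reasoning
    x*[y*z]≡y*[x*z] : ∀ x y z → x * (y * z) ≡ y * (x * z)
    x*[y*z]≡y*[x*z] = solve-∀

  -- With B = D + 1, starting from L₀ = B (where 4 ^ B ≥ 2B) and running m = X·B^B further
  -- steps, f gains the factor (2B)^m = 2^m B^m > m B^m = X B^(m + B).
  f-beats-exponentials : (∀ L → 1 ≤ f L) → ∀ X D → ∃ λ L → X * D ^ L < f L
  f-beats-exponentials f-pos X D = m + B , (begin-strict
    X * D ^ (m + B)       ≤⟨ *-monoʳ-≤ X (^-monoˡ-≤ (m + B) (n≤1+n D)) ⟩
    X * B ^ (m + B)       ≡⟨ cong (X *_) (^-distribˡ-+-* B m B) ⟩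
    X * (B ^ m * B ^ B)   ≡⟨ regroup X (B ^ m) (B ^ B) ⟩
    m * B ^ m             <⟨ *-monoˡ-< (B ^ m) {{>-nonZero (m^n>0 B m)}} (n<2^n m) ⟩
    2 ^ m * B ^ m         ≡⟨ ^-distribʳ-* 2 B m ⟨
    (2 * B) ^ m           ≤⟨ m≤n*m ((2 * B) ^ m) (f B) {{>-nonZero (f-pos B)}} ⟩
    f B * (2 * B) ^ m     ≤⟨ f-geometric 2B≤4^B m ⟩
    f (m + B)             ∎)
    where
    open ≤-Reasoning
    B : ℕ
    B = suc D
    m : ℕ
    m = X * B ^ B
    regroup : ∀ x a b → x * (a * b) ≡ x * b * a
    regroup = solve-∀
    2B≤4^B : 2 * B ≤ 4 ^ B
    2B≤4^B = ≤-trans (<⇒≤ (n<2^n (2 * B))) (≤-reflexive (sym (^-*-assoc 2 2 B)))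

sumℕ : (r : ℕ) → (Fin r → ℕ) → ℕ
sumℕ zero    f = 0
sumℕ (suc r) f = f Fin.zero + sumℕ r (f ∘ Fin.suc)

≤-sumℕ : ∀ {r} (f : Fin r → ℕ) t → f t ≤ sumℕ r f
≤-sumℕ f Fin.zero    = m≤m+n _ _
≤-sumℕ f (Fin.suc t) = ≤-trans (≤-sumℕ (f ∘ Fin.suc) t) (m≤n+m _ _)

sumℕ-mono : ∀ {r} {f g : Fin r → ℕ} → (∀ t → f t ≤ g t) → sumℕ r f ≤ sumℕ r g
sumℕ-mono {zero}  f≤g = z≤n
sumℕ-mono {suc r} f≤g = +-mono-≤ (f≤g Fin.zero) (sumℕ-mono (f≤g ∘ Fin.suc))

sumℕ-*ʳ : ∀ {r} (c : Fin r → ℕ) x → sumℕ r (λ t → c t * x) ≡ sumℕ r c * x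
sumℕ-*ʳ {zero}  c x = refl
sumℕ-*ʳ {suc r} c x =
  trans (cong (λ y → c Fin.zero * x + y) (sumℕ-*ʳ (c ∘ Fin.suc) x)) (sym (*-distribʳ-+ x (c Fin.zero) _))

∣sumFin∣≤sumℕ∣∣ : ∀ r (f : Fin r → ℤ.ℤ) → ∣ sumFin r f ∣ ≤ sumℕ r (∣_∣ ∘ f)
∣sumFin∣≤sumℕ∣∣ zero    f = z≤n
∣sumFin∣≤sumℕ∣∣ (suc r) f =
  ≤-trans (ℤ.∣i+j∣≤∣i∣+∣j∣ (f Fin.zero) _) (+-monoʳ-≤ ∣ f Fin.zero ∣ (∣sumFin∣≤sumℕ∣∣ r (f ∘ Fin.suc)))

InSpan-single : ∀ {P s} → P s → InSpan P s
InSpan-single {s = s} Ps = 1 , (λ _ → s) , (λ _ → + 1) , (λ _ → Ps) ,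
  λ n → sym (trans (ℤ.+-identityʳ _) (ℤ.*-identityˡ (s n)))

InSpan-∘ : ∀ {P Q : Seq → Set} (σ : ℕ → ℕ) → (∀ {g} → P g → Q (g ∘ σ)) →
           ∀ {s} → InSpan P s → InSpan Q (s ∘ σ)
InSpan-∘ σ P⇒Q (r , gs , cs , gs∈P , s≡) = r , (λ t → gs t ∘ σ) , cs , (P⇒Q ∘ gs∈P) , s≡ ∘ σ

InKernel-self : ∀ k a → InKernel k a a
InKernel-self k a = 0 , 0 , s≤s z≤n , λ n → cong a (sym (trans (+-identityʳ _) (*-identityˡ n)))

InKernel-digit : ∀ {k a g d} → d < k → InKernel k a g → InKernel k a (λ n → g (k * n + d))
InKernel-digit {k} {a} {d = d} d<k (j , i , i<k^j , g≡) =
  suc j , k ^ j * d + i , i′<k^[1+j] , λ n → trans (g≡ (k * n + d)) (cong a (regroup (k ^ j) k n d i))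
  where
  regroup : ∀ p k n d i → p * (k * n + d) + i ≡ k * p * n + (p * d + i)
  regroup = solve-∀
  i′<k^[1+j] : k ^ j * d + i < k ^ suc j
  i′<k^[1+j] = begin-strict
    k ^ j * d + i       <⟨ +-monoʳ-< (k ^ j * d) i<k^j ⟩
    k ^ j * d + k ^ j   ≡⟨ +-comm (k ^ j * d) (k ^ j) ⟩
    k ^ j + k ^ j * d   ≡⟨ *-suc (k ^ j) d ⟨
    k ^ j * suc d       ≤⟨ *-monoʳ-≤ (k ^ j) d<k ⟩
    k ^ j * k           ≡⟨ *-comm (k ^ j) k ⟩
    k ^ suc j           ∎
    where open ≤-Reasoning

InSpan-finite-bound : ∀ {r G s} → InSpan (FinSet r G) s →
                      ∃ λ W → ∀ n → ∣ s n ∣ ≤ W * sumℕ r (λ t → ∣ G t n ∣)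
InSpan-finite-bound {r} {G} {s} (r′ , gs , cs , gs∈G , s≡) = sumℕ r′ (∣_∣ ∘ cs) , λ n → begin
  ∣ s n ∣                               ≡⟨ cong ∣_∣ (s≡ n) ⟩
  ∣ sumFin r′ (λ u → cs u ℤ.* gs u n) ∣ ≤⟨ ∣sumFin∣≤sumℕ∣∣ r′ _ ⟩
  sumℕ r′ (λ u → ∣ cs u ℤ.* gs u n ∣)   ≤⟨ sumℕ-mono (λ u → ≤-trans (≤-reflexive (ℤ.abs-* (cs u) (gs u n)))
                                                                (*-monoʳ-≤ ∣ cs u ∣ (gs≤M u n))) ⟩
  sumℕ r′ (λ u → ∣ cs u ∣ * M n)        ≡⟨ sumℕ-*ʳ (∣_∣ ∘ cs) (M n) ⟩
  sumℕ r′ (∣_∣ ∘ cs) * M n              ∎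
  where
  open ≤-Reasoning
  M : ℕ → ℕ
  M n = sumℕ r (λ t → ∣ G t n ∣)
  gs≤M : ∀ u n → ∣ gs u n ∣ ≤ M n
  gs≤M u n with gs∈G u
  ... | t , gs≡G rewrite gs≡G n = ≤-sumℕ (λ t → ∣ G t n ∣) t

digits-bound : ∀ {k} .{{_ : NonZero k}} (M : ℕ → ℕ) C →
               (∀ n (d : Fin k) → M (k * n + toℕ d) ≤ C * M n) →
               ∀ L n → n < k ^ L → M n ≤ M 0 * C ^ L
digits-bound M C step zero    zero    (s≤s z≤n) = ≤-reflexive (sym (*-identityʳ (M 0)))
digits-bound {k} M C step (suc L) n n<k^[1+L] = begin
  M n                     ≡⟨ cong M n≡ ⟩
  M (k * (n / k) + toℕ d) ≤⟨ step (n / k) d ⟩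
  C * M (n / k)           ≤⟨ *-monoʳ-≤ C (digits-bound M C step L (n / k) n/k<k^L) ⟩
  C * (M 0 * C ^ L)       ≡⟨ x*[y*z]≡y*[x*z] C (M 0) (C ^ L) ⟩
  M 0 * C ^ suc L         ∎
  where
  open ≤-Reasoning
  d : Fin k
  d = fromℕ< (m%n<n n k)
  n≡ : n ≡ k * (n / k) + toℕ d
  n≡ = trans (m≡m%n+[m/n]*n n k)
       (trans (+-comm (n % k) _) (cong₂ _+_ (*-comm (n / k) k) (sym (toℕ-fromℕ< (m%n<n n k)))))
  n/k<k^L : n / k < k ^ L
  n/k<k^L = m<n*o⇒m/o<n (subst (n <_) (*-comm k (k ^ L)) n<k^[1+L])
  x*[y*z]≡y*[x*z] : ∀ x y z → x * (y * z) ≡ y * (x * z)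
  x*[y*z]≡y*[x*z] = solve-∀

-- Equivalently ∣ a n ∣ = O(n ^ logₖ C).
record PolynomiallyBounded (k : ℕ) (a : Seq) : Set where
  constructor bounded-by
  field
    A C   : ℕ
    bound : ∀ L n → n < k ^ L → ∣ a n ∣ ≤ A * C ^ L

regular⇒polynomiallyBounded : ∀ {k} .{{_ : NonZero k}} a → Regular k a → PolynomiallyBounded k a
regular⇒polynomiallyBounded {k} a (r , G , G∈span , span⊆G) = bounded-by (W₀ * M 0) C λ L n n<k^L → begin
  ∣ a n ∣            ≤⟨ a≤W₀*M n ⟩
  W₀ * M n           ≤⟨ *-monoʳ-≤ W₀ (digits-bound M C step L n n<k^L) ⟩
  W₀ * (M 0 * C ^ L) ≡⟨ *-assoc W₀ (M 0) (C ^ L) ⟨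
  W₀ * M 0 * C ^ L   ∎
  where
  open ≤-Reasoning
  M : ℕ → ℕ
  M n = sumℕ r (λ t → ∣ G t n ∣)
  bound : ∀ {s} → InSpan (InKernel k a) s → ∃ λ W → ∀ n → ∣ s n ∣ ≤ W * M n
  bound {s} = InSpan-finite-bound ∘ span⊆G s
  a∈span : InSpan (InKernel k a) a
  a∈span = InSpan-single {P = InKernel k a} (InKernel-self k a)
  W₀ : ℕ
  W₀ = proj₁ (bound a∈span)
  a≤W₀*M : ∀ n → ∣ a n ∣ ≤ W₀ * M n
  a≤W₀*M = proj₂ (bound a∈span)
  digit-span : ∀ t (d : Fin k) → InSpan (InKernel k a) (λ n → G t (k * n + toℕ d))
  digit-span t d = InSpan-∘ {Q = InKernel k a} (λ n → k * n + toℕ d)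
                             (λ {g} → InKernel-digit {a = a} {g} (toℕ<n d)) (G∈span t)
  W : Fin r → Fin k → ℕ
  W t d = proj₁ (bound (digit-span t d))
  C : ℕ
  C = sumℕ k (λ d → sumℕ r (λ t → W t d))
  step : ∀ n d → M (k * n + toℕ d) ≤ C * M n
  step n d = begin
    M (k * n + toℕ d)          ≤⟨ sumℕ-mono (λ t → proj₂ (bound (digit-span t d)) n) ⟩
    sumℕ r (λ t → W t d * M n) ≡⟨ sumℕ-*ʳ (λ t → W t d) (M n) ⟩
    sumℕ r (λ t → W t d) * M n ≤⟨ *-monoˡ-≤ (M n) (≤-sumℕ (λ d → sumℕ r (λ t → W t d)) d) ⟩
    C * M n                    ∎

polynomiallyBounded-∘* : ∀ {k m a} .{{_ : NonZero k}} → m ≤ k →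
                         PolynomiallyBounded k a → PolynomiallyBounded k (λ n → a (m * n))
polynomiallyBounded-∘* {k} {m} m≤k (bounded-by A C bound) = bounded-by (A * C) C λ L n n<k^L →
  ≤-trans (bound (suc L) (m * n) (≤-<-trans (*-monoˡ-≤ n m≤k) (*-monoʳ-< k n<k^L)))
          (≤-reflexive (sym (*-assoc A C (C ^ L))))

tab-pos : ∀ n i → 1 ≤ tab n i
tab-pos zero          i = s≤s z≤n
tab-pos (suc n)       i with i ≤ᵇ n
... | true = tab-pos n i
tab-pos (suc zero)    i | false = s≤s z≤n
tab-pos (suc (suc m)) i | false = ≤-trans (tab-pos (suc m) _) (m≤m+n _ (tab (suc m) m))

h-pos : ∀ n → 1 ≤ h n
h-pos n = tab-pos n n

1+n≰ᵇn : ∀ n → (suc n ≤ᵇ n) ≡ false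
1+n≰ᵇn zero    = refl
1+n≰ᵇn (suc n) = 1+n≰ᵇn n

tab-stable : ∀ {n i} → i ≤ n → tab n i ≡ h i
tab-stable {zero}      z≤n = refl
tab-stable {suc n} {i} i≤1+n with m≤n⇒m<n∨m≡n i≤1+n
... | inj₂ refl = refl
... | inj₁ (s≤s i≤n) rewrite Equivalence.to T-≡ (≤⇒≤ᵇ i≤n) = tab-stable i≤n

h-unfold : ∀ m → h (2 + m) ≡ tab (1 + m) (2 + m ∸ tab (1 + m) (1 + m)) + tab (1 + m) m
h-unfold m with 2 + m ≤ᵇ 1 + m | 1+n≰ᵇn (1 + m)
... | .false | refl = refl

h-suc-suc : ∀ m → h (2 + m) ≡ h (2 + m ∸ h (1 + m)) + h m
h-suc-suc m = trans (h-unfold m)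
  (cong₂ _+_ (tab-stable (∸-monoʳ-≤ (2 + m) (h-pos (1 + m)))) (tab-stable (n≤1+n m)))

h-≤1 : ∀ {n} → n ≤ 1 → h n ≡ 1
h-≤1 z≤n       = refl
h-≤1 (s≤s z≤n) = refl

h-even-step : ∀ n → h (1 + 2 * n) ≡ 1 + n → h (2 + 2 * n) ≡ h (1 + n) + h (2 * n)
h-even-step n h-odd = begin
  h (2 + 2 * n)                               ≡⟨ h-suc-suc (2 * n) ⟩
  h (2 + 2 * n ∸ h (1 + 2 * n)) + h (2 * n)   ≡⟨ cong (λ x → h (2 + 2 * n ∸ x) + h (2 * n)) h-odd ⟩
  h (2 + 2 * n ∸ (1 + n)) + h (2 * n)         ≡⟨ cong (λ x → h (x ∸ (1 + n)) + h (2 * n)) (double n) ⟩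
  h ((1 + n) + (1 + n) ∸ (1 + n)) + h (2 * n) ≡⟨ cong (λ x → h x + h (2 * n)) (m+n∸n≡m (1 + n) (1 + n)) ⟩
  h (1 + n) + h (2 * n)                       ∎
  where
  open ≡-Reasoning
  double : ∀ m → 2 + 2 * m ≡ (1 + m) + (1 + m)
  double = solve-∀

h-odd-step : ∀ n → 2 + 2 * n ≤ h (2 + 2 * n) → h (1 + 2 * n) ≡ 1 + n → h (3 + 2 * n) ≡ 2 + n
h-odd-step n h-even h-odd = begin
  h (3 + 2 * n)                                 ≡⟨ h-suc-suc (1 + 2 * n) ⟩
  h (3 + 2 * n ∸ h (2 + 2 * n)) + h (1 + 2 * n) ≡⟨ cong₂ _+_ (h-≤1 index≤1) h-odd ⟩
  2 + n                                         ∎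
  where
  open ≡-Reasoning
  index≤1 : 3 + 2 * n ∸ h (2 + 2 * n) ≤ 1
  index≤1 = ≤-trans (∸-monoʳ-≤ (3 + 2 * n) h-even) (≤-reflexive (m+n∸n≡m 1 (2 + 2 * n)))

-- The three facts are proved simultaneously: each of them at n + 1 uses the others at n.
record Invariant (n : ℕ) : Set where
  field
    odd  : h (1 + 2 * n) ≡ 1 + n
    even : 2 + 2 * n ≤ h (2 + 2 * n)
    ≥2   : ∀ {m} → 2 ≤ m → m ≤ 2 + 2 * n → 2 ≤ h m

invariant-zero : Invariant 0
invariant-zero = record { odd = refl ; even = ≤-refl ; ≥2 = ≥2 }
  where
  ≥2 : ∀ {m} → 2 ≤ m → m ≤ 2 → 2 ≤ h m
  ≥2 2≤m m≤2 rewrite ≤-antisym m≤2 2≤m = ≤-refl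

invariant-suc : ∀ {n} → Invariant n → Invariant (suc n)
invariant-suc {n} inv = record { odd = odd′ ; even = even′ ; ≥2 = ≥2′ }
  where
  open Invariant inv
  open ≤-Reasoning
  odd′ : h (1 + 2 * suc n) ≡ 2 + n
  odd′ = subst (λ x → h (1 + x) ≡ 2 + n) (sym (*-suc 2 n)) (h-odd-step n even odd)
  even′ : 2 + 2 * suc n ≤ h (2 + 2 * suc n)
  even′ = begin
    2 + 2 * suc n             ≡⟨ +-comm 2 (2 * suc n) ⟩
    2 * suc n + 2             ≤⟨ +-mono-≤ (subst (λ x → x ≤ h x) (sym (*-suc 2 n)) even)
                                          (≥2 (m≤m+n 2 n) (+-monoʳ-≤ 2 (m≤n*m n 2))) ⟩
    h (2 * suc n) + h (2 + n) ≡⟨ +-comm (h (2 * suc n)) (h (2 + n)) ⟩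
    h (2 + n) + h (2 * suc n) ≡⟨ h-even-step (suc n) odd′ ⟨
    h (2 + 2 * suc n)         ∎
  ≥2′ : ∀ {m} → 2 ≤ m → m ≤ 2 + 2 * suc n → 2 ≤ h m
  ≥2′ {m} 2≤m m≤4+2n with m ≤? 2 + 2 * n
  ... | yes m≤2+2n = ≥2 2≤m m≤2+2n
  ... | no  m≰2+2n with m≤n⇒m<n∨m≡n m≤4+2n
  ...   | inj₂ refl = ≤-trans 2≤m even′
  ...   | inj₁ (s≤s m≤3+2n) with m≤n⇒m<n∨m≡n m≤3+2n
  ...     | inj₂ refl = ≤-trans (m≤m+n 2 n) (≤-reflexive (sym odd′))
  ...     | inj₁ (s≤s m≤2+2n) = ⊥-elim (m≰2+2n (≤-trans m≤2+2n (≤-reflexive (*-suc 2 n))))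

invariant : ∀ n → Invariant n
invariant zero    = invariant-zero
invariant (suc n) = invariant-suc (invariant n)

h-odd : ∀ n → h (1 + 2 * n) ≡ 1 + n
h-odd n = Invariant.odd (invariant n)

hEven : ℕ → ℕ
hEven n = h (2 * n)

hEven-suc : ∀ n → hEven (suc n) ≡ h (suc n) + hEven n
hEven-suc n = trans (cong h (*-suc 2 n)) (h-even-step n (h-odd n))

hEven-≤-suc : ∀ n → hEven n ≤ hEven (suc n)
hEven-≤-suc n = ≤-trans (m≤n+m (hEven n) (h (suc n))) (≤-reflexive (sym (hEven-suc n)))

hEven-mono : ∀ {m n} → m ≤ n → hEven m ≤ hEven n
hEven-mono = mono′ ∘ ≤⇒≤′
  where
  mono′ : ∀ {m n} → m ≤′ n → hEven m ≤ hEven n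
  mono′ ≤′-refl           = ≤-refl
  mono′ (≤′-step {n} m≤n) = ≤-trans (mono′ m≤n) (hEven-≤-suc n)

hEven-double-suc : ∀ p → hEven (suc p) + hEven (2 * p) ≤ hEven (2 * suc p)
hEven-double-suc p = begin
  hEven (suc p) + hEven (2 * p)     ≤⟨ +-monoʳ-≤ (hEven (suc p)) (hEven-≤-suc (2 * p)) ⟩
  hEven (suc p) + hEven (1 + 2 * p) ≡⟨ cong (λ x → h x + hEven (1 + 2 * p)) (*-suc 2 p) ⟩
  h (2 + 2 * p) + hEven (1 + 2 * p) ≡⟨ hEven-suc (1 + 2 * p) ⟨
  hEven (2 + 2 * p)                 ≡⟨ cong hEven (*-suc 2 p) ⟨
  hEven (2 * suc p)                 ∎
  where open ≤-Reasoning

*-hEven≤hEven-double : ∀ m j → j * hEven m ≤ hEven (2 * (m + j))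
*-hEven≤hEven-double m zero    = z≤n
*-hEven≤hEven-double m (suc j) = begin
  hEven m + j * hEven m                     ≤⟨ +-mono-≤ (hEven-mono (≤-trans (m≤m+n m j) (n≤1+n (m + j))))
                                                        (*-hEven≤hEven-double m j) ⟩
  hEven (suc (m + j)) + hEven (2 * (m + j)) ≤⟨ hEven-double-suc (m + j) ⟩
  hEven (2 * suc (m + j))                   ≡⟨ cong (λ x → hEven (2 * x)) (+-suc m j) ⟨
  hEven (2 * (m + suc j))                   ∎
  where open ≤-Reasoning

*-hEven≤hEven-*4 : ∀ m → m * hEven m ≤ hEven (4 * m)
*-hEven≤hEven-*4 m = ≤-trans (*-hEven≤hEven-double m m) (≤-reflexive (cong hEven (double-double m)))
  where
  double-double : ∀ m → 2 * (m + m) ≡ 4 * m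
  double-double = solve-∀

hEven-4^-beats-exponentials : ∀ X D → ∃ λ L → X * D ^ L < hEven (4 ^ L)
hEven-4^-beats-exponentials =
  f-beats-exponentials (λ L → hEven (4 ^ L)) (λ L → *-hEven≤hEven-*4 (4 ^ L)) (λ L → h-pos (2 * 4 ^ L))

¬polynomiallyBounded-hEven : ∀ {k} → 2 ≤ k → ¬ PolynomiallyBounded k (λ n → + hEven n)
¬polynomiallyBounded-hEven {k} 2≤k (bounded-by A C bound)
  with hEven-4^-beats-exponentials (A * C) (C ^ 2)
... | L , beats = <⇒≱ beats (begin
  hEven (4 ^ L)         ≤⟨ bound (suc (2 * L)) (4 ^ L) 4^L<k^[1+2L] ⟩
  A * (C * C ^ (2 * L)) ≡⟨ *-assoc A C _ ⟨
  A * C * C ^ (2 * L)   ≡⟨ cong (A * C *_) (^-*-assoc C 2 L) ⟨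
  A * C * (C ^ 2) ^ L   ∎)
  where
  open ≤-Reasoning
  instance
    k≢0 : NonZero k
    k≢0 = >-nonZero (≤-trans (s≤s z≤n) 2≤k)
  4^L<k^[1+2L] : 4 ^ L < k ^ suc (2 * L)
  4^L<k^[1+2L] = begin-strict
    (2 ^ 2) ^ L     ≤⟨ ^-monoˡ-≤ L (^-monoˡ-≤ 2 2≤k) ⟩
    (k ^ 2) ^ L     ≡⟨ ^-*-assoc k 2 L ⟩
    k ^ (2 * L)     <⟨ m<m*n (k ^ (2 * L)) k {{m^n≢0 k (2 * L)}} 2≤k ⟩
    k ^ (2 * L) * k ≡⟨ *-comm (k ^ (2 * L)) k ⟩
    k ^ suc (2 * L) ∎

theorem3p7 : (k : ℕ) → 2 ≤ k →
    ¬ Regular k (λ n → + h (2 * n)) × ¬ Regular k (λ n → + h n)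
theorem3p7 k 2≤k = ¬regular-hEven , ¬regular-h
  where
  instance
    k≢0 : NonZero k
    k≢0 = >-nonZero (≤-trans (s≤s z≤n) 2≤k)
  ¬regular-hEven : ¬ Regular k (λ n → + h (2 * n))
  ¬regular-hEven = ¬polynomiallyBounded-hEven 2≤k ∘ regular⇒polynomiallyBounded (λ n → + hEven n)
  ¬regular-h : ¬ Regular k (λ n → + h n)
  ¬regular-h =
    ¬polynomiallyBounded-hEven 2≤k ∘ polynomiallyBounded-∘* 2≤k ∘ regular⇒polynomiallyBounded (λ n → + h n)
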